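{- Let $\mathcal{F}$ be a $t$-intersecting family on $n$ points, and let $A,B \subseteq [n]$ be disjoint sets with $|A| = s$ and $|B| = s+1$. If $\mathcal{F}$ is $(r,r+1)$-stable for all $r < s$ then $\mathsf{S}_{A,B}(\mathcal{F})$ is $t$-intersecting as well.
   Context: A family on $n$ points is a collection of subsets of $[n]$; $t$-intersecting means any two members share at least $t$ elements. For disjoint $A,B\subseteq[n]$, let $\mathcal{F}_{A,B}$ be the sets in $\mathcal{F}$ containing $A$ and disjoint from $B$; the shift $\mathsf{S}_{A,B}(\mathcal{F})$ is obtained from $\mathcal{F}$ by replacing each $S\in\mathcal{F}_{A,B}$ with $S'=(S\setminus A)\cup B$ whenever $S'\notin\mathcal{F}$ (and keeping $S$ otherwise). $\mathcal{F}$ is $(r,r+1)$-stable if $\mathsf{S}_{C,D}(\mathcal{F})=\mathcal{F}$ for all disjoint $C,D\subseteq[n]$ with $|C|=r$, $|D|=r+1$. -}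

module Defs where

open import Data.Nat using (ℕ; _≤_; _<_; suc)
open import Data.Fin.Subset using (Subset; _∩_; _∪_; _─_; _⊆_; ∣_∣; Empty)
open import Data.Product using (_×_; Σ; _,_)
open import Data.Sum using (_⊎_)
open import Relation.Nullary using (¬_)
open import Relation.Binary.PropositionalEquality using (_≡_)

Family : ℕ → Set₁
Family n = Subset n → Set

Disjoint : ∀ {n} → Subset n → Subset n → Set
Disjoint X Y = Empty (X ∩ Y)

IsTIntersecting : ∀ {n} → ℕ → Family n → Set
IsTIntersecting t F = ∀ S T → F S → F T → t ≤ ∣ S ∩ T ∣

InFAB : ∀ {n} → Family n → Subset n → Subset n → Subset n → Set
InFAB F A B S = F S × (A ⊆ S) × Disjoint S B

shiftSet : ∀ {n} → Subset n → Subset n → Subset n → Subset n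
shiftSet A B S = (S ─ A) ∪ B

-- The shift S_{A,B}(F): each S ∈ F_{A,B} is replaced by S' = (S\A)∪B
-- when S' ∉ F; all other members are kept.
Shift : ∀ {n} → Subset n → Subset n → Family n → Family n
Shift A B F X =
    (Σ _ λ S → InFAB F A B S × ¬ F (shiftSet A B S) × X ≡ shiftSet A B S)
  ⊎ (F X × ¬ (InFAB F A B X × ¬ F (shiftSet A B X)))

_≐_ : ∀ {n} → Family n → Family n → Set
F ≐ G = ∀ X → (F X → G X) × (G X → F X)

IsStable : ∀ {n} → ℕ → Family n → Set
IsStable r F = ∀ C D → Disjoint C D → ∣ C ∣ ≡ r → ∣ D ∣ ≡ suc r → Shift C D F ≐ F

module Submission where

-- Write S' = (S ─ A) ∪ B.  Two shifted members meet in |S ∩ T| + 1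
-- elements and two kept members are members of F, so the only real case
-- is a shifted S' against a kept Y.  With a = |A ∩ Y|, b = |B ∩ Y| and
-- k = |S ∩ Y| one has |S' ∩ Y| + a = k + b, so it suffices to find r with
-- t + r ≤ k and a ≤ r + b.  If a ≤ b take r = 0.  Otherwise r = a - b: for
-- r < s pick C ⊆ A ∩ Y of size r and D ⊆ B ─ Y of size r + 1, and use that
-- Y, being fixed by the stable shift along (C, D), compresses to a member
-- Y_{C,D} of F, which meets S in k - r elements; for r = s the same holds
-- for (C, D) = (A, B) because Y was kept by the shift itself.

open import Defs
open import Data.Nat using (ℕ; zero; suc; _+_; _∸_; _≤_; _<_; s≤s; _≤?_; _<?_)
open import Data.Nat.Properties
open import Data.Bool using (Bool; true; false; _∧_; _∨_; not)
import Data.Bool as Bool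
import Data.Bool.Properties as Boolₚ
open import Data.Fin using (zero; suc)
open import Data.Fin.Subset using (Subset; ∣_∣; _∩_; _∪_; _─_; _⊆_; _-_; Empty; inside; outside; ⊥)
open import Data.Fin.Subset.Properties
  using (Empty-unique; ∩-comm; q⊆p∪q; x∈p∩q⁺; x∈p∩q⁻; x∈p∧x∉q⇒x∈p─q; x∈p⇒∣p-x∣<∣p∣; _∈?_;
         ∣p∩q∣≤∣p∣; p∩q⊆p; p∩q⊆q; p─q⊆p; ⊆-refl; ⊥⊆; out⊆; in⊆in; ∣⊥∣≡0)
open import Data.Vec using ([]; _∷_; lookup)
open import Data.Vec.Properties using (lookup-zipWith; lookup-replicate; []=⇒lookup; lookup⇒[]=)
open import Data.Product using (Σ; _×_; _,_; proj₂)
open import Data.Sum using (inj₁; inj₂)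
open import Data.Empty using (⊥-elim)
open import Function using (_∘_)
open import Relation.Nullary using (¬_; yes; no; contradiction)
open import Relation.Nullary.Decidable using (decidable-stable)
open import Relation.Binary.PropositionalEquality
  using (_≡_; refl; sym; trans; cong; cong₂; subst; module ≡-Reasoning)
open import Algebra.Properties.CommutativeSemigroup +-commutativeSemigroup using (interchange)

𝟙 : Bool → ℕ
𝟙 true  = 1
𝟙 false = 0

∣∷∣ : ∀ {n} x (p : Subset n) → ∣ x ∷ p ∣ ≡ 𝟙 x + ∣ p ∣
∣∷∣ true  p = refl
∣∷∣ false p = refl

count-pointwise : ∀ {n} (P Q R W : Subset n) →
  (∀ i → 𝟙 (lookup P i) + 𝟙 (lookup Q i) ≡ 𝟙 (lookup R i) + 𝟙 (lookup W i)) →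
  ∣ P ∣ + ∣ Q ∣ ≡ ∣ R ∣ + ∣ W ∣
count-pointwise [] [] [] [] _ = refl
count-pointwise (p ∷ P) (q ∷ Q) (r ∷ R) (w ∷ W) eq = begin
  ∣ p ∷ P ∣ + ∣ q ∷ Q ∣         ≡⟨ cong₂ _+_ (∣∷∣ p P) (∣∷∣ q Q) ⟩
  (𝟙 p + ∣ P ∣) + (𝟙 q + ∣ Q ∣) ≡⟨ interchange (𝟙 p) (∣ P ∣) (𝟙 q) (∣ Q ∣) ⟩
  (𝟙 p + 𝟙 q) + (∣ P ∣ + ∣ Q ∣) ≡⟨ cong₂ _+_ (eq zero) (count-pointwise P Q R W (eq ∘ suc)) ⟩
  (𝟙 r + 𝟙 w) + (∣ R ∣ + ∣ W ∣) ≡⟨ interchange (𝟙 r) (𝟙 w) (∣ R ∣) (∣ W ∣) ⟩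
  (𝟙 r + ∣ R ∣) + (𝟙 w + ∣ W ∣) ≡⟨ cong₂ _+_ (∣∷∣ r R) (∣∷∣ w W) ⟨
  ∣ r ∷ R ∣ + ∣ w ∷ W ∣         ∎
  where open ≡-Reasoning

count-pointwise₃ : ∀ {n} (P Q R : Subset n) →
  (∀ i → 𝟙 (lookup P i) + 𝟙 (lookup Q i) ≡ 𝟙 (lookup R i)) →
  ∣ P ∣ + ∣ Q ∣ ≡ ∣ R ∣
count-pointwise₃ {n} P Q R eq = begin
  ∣ P ∣ + ∣ Q ∣      ≡⟨ count-pointwise P Q R (⊥ {n}) pad ⟩
  ∣ R ∣ + ∣ ⊥ {n} ∣  ≡⟨ cong (∣ R ∣ +_) (∣⊥∣≡0 n) ⟩
  ∣ R ∣ + 0          ≡⟨ +-identityʳ ∣ R ∣ ⟩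
  ∣ R ∣              ∎
  where
  open ≡-Reasoning
  pad : ∀ i → 𝟙 (lookup P i) + 𝟙 (lookup Q i) ≡ 𝟙 (lookup R i) + 𝟙 (lookup (⊥ {n}) i)
  pad i rewrite lookup-replicate i outside = trans (eq i) (sym (+-identityʳ _))

bit-∩ : ∀ {n} (p q : Subset n) i → lookup (p ∩ q) i ≡ lookup p i ∧ lookup q i
bit-∩ p q i = lookup-zipWith _∧_ i p q

bit-∪ : ∀ {n} (p q : Subset n) i → lookup (p ∪ q) i ≡ lookup p i ∨ lookup q i
bit-∪ p q i = lookup-zipWith _∨_ i p q

bit-─ : ∀ {n} (p q : Subset n) i → lookup (p ─ q) i ≡ lookup p i ∧ not (lookup q i)
bit-─ (x ∷ p) (true  ∷ q) zero    = sym (Boolₚ.∧-zeroʳ x)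
bit-─ (x ∷ p) (false ∷ q) zero    = sym (Boolₚ.∧-identityʳ x)
bit-─ (x ∷ p) (y     ∷ q) (suc i) = bit-─ p q i

⊆⇒bit≤ : ∀ {n} {p q : Subset n} → p ⊆ q → ∀ i → lookup p i Bool.≤ lookup q i
⊆⇒bit≤ {p = p} p⊆q i with lookup p i in eq
... | false = Boolₚ.≤-minimum _
... | true  = Boolₚ.≤-reflexive (sym ([]=⇒lookup (p⊆q (lookup⇒[]= i p eq))))

disjoint⇒bit : ∀ {n} {p q : Subset n} → Disjoint p q → ∀ i → lookup p i ∧ lookup q i ≡ false
disjoint⇒bit {p = p} {q} p∩q=∅ i = begin
  lookup p i ∧ lookup q i ≡⟨ bit-∩ p q i ⟨
  lookup (p ∩ q) i        ≡⟨ cong (λ r → lookup r i) (Empty-unique p∩q=∅) ⟩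
  lookup ⊥ i              ≡⟨ lookup-replicate i outside ⟩
  false                   ∎
  where open ≡-Reasoning

-- Truth tables behind the cardinality identities below, one coordinate at a
-- time (a ≤ s encodes A ⊆ S, s ∧ b ≡ false encodes S ∩ B = ∅).
shift-meet-bit : ∀ s y a b → a Bool.≤ s → s ∧ b ≡ false →
  𝟙 ((s ∧ not a ∨ b) ∧ y) + 𝟙 (a ∧ y) ≡ 𝟙 (s ∧ y) + 𝟙 (b ∧ y)
shift-meet-bit true  true  true  false _ _ = refl
shift-meet-bit true  true  false false _ _ = refl
shift-meet-bit true  false true  false _ _ = refl
shift-meet-bit true  false false false _ _ = refl
shift-meet-bit false true  false true  _ _ = refl
shift-meet-bit false true  false false _ _ = refl
shift-meet-bit false false false true  _ _ = refl
shift-meet-bit false false false false _ _ = refl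
shift-meet-bit true  _     _     true  _ ()
shift-meet-bit false _     true  _     () _

shift-shift-bit : ∀ s u a b → a Bool.≤ s → a Bool.≤ u → s ∧ b ≡ false → u ∧ b ≡ false →
  𝟙 ((s ∧ not a ∨ b) ∧ (u ∧ not a ∨ b)) + 𝟙 a ≡ 𝟙 (s ∧ u) + 𝟙 b
shift-shift-bit true  true  true  false _ _ _ _ = refl
shift-shift-bit true  true  false false _ _ _ _ = refl
shift-shift-bit true  false false false _ _ _ _ = refl
shift-shift-bit false true  false false _ _ _ _ = refl
shift-shift-bit false false false true  _ _ _ _ = refl
shift-shift-bit false false false false _ _ _ _ = refl
shift-shift-bit true  _     _     true  _ _ () _
shift-shift-bit false _     true  _     () _ _ _
shift-shift-bit true  false true  _     _ () _ _
shift-shift-bit false true  false true  _ _ _ ()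

compression-meet-bit : ∀ s y c d → c Bool.≤ s → c Bool.≤ y → s ∧ d ≡ false →
  𝟙 (s ∧ (y ∧ not c ∨ d)) + 𝟙 c ≡ 𝟙 (s ∧ y)
compression-meet-bit true  true  true  false _ _ _ = refl
compression-meet-bit true  true  false false _ _ _ = refl
compression-meet-bit true  false false false _ _ _ = refl
compression-meet-bit false y     false d     _ _ _ = refl
compression-meet-bit true  _     _     true  _ _ ()
compression-meet-bit false _     true  _     () _ _
compression-meet-bit true  false true  _     _ () _

split-bit : ∀ x y → 𝟙 (x ∧ not y) + 𝟙 (x ∧ y) ≡ 𝟙 x
split-bit true  true  = refl
split-bit true  false = refl
split-bit false y     = refl

shift-meet : ∀ {n} (A B S Y : Subset n) → A ⊆ S → Disjoint S B →
  ∣ shiftSet A B S ∩ Y ∣ + ∣ A ∩ Y ∣ ≡ ∣ S ∩ Y ∣ + ∣ B ∩ Y ∣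
shift-meet A B S Y A⊆S S∩B=∅ =
  count-pointwise (shiftSet A B S ∩ Y) (A ∩ Y) (S ∩ Y) (B ∩ Y) pointwise
  where
  pointwise : ∀ i → 𝟙 (lookup (shiftSet A B S ∩ Y) i) + 𝟙 (lookup (A ∩ Y) i)
                  ≡ 𝟙 (lookup (S ∩ Y) i) + 𝟙 (lookup (B ∩ Y) i)
  pointwise i
    rewrite bit-∩ (shiftSet A B S) Y i | bit-∪ (S ─ A) B i | bit-─ S A i
          | bit-∩ A Y i | bit-∩ S Y i | bit-∩ B Y i
    = shift-meet-bit _ _ _ _ (⊆⇒bit≤ A⊆S i) (disjoint⇒bit S∩B=∅ i)

shift-shift : ∀ {n} (A B S T : Subset n) → A ⊆ S → A ⊆ T → Disjoint S B → Disjoint T B →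
  ∣ shiftSet A B S ∩ shiftSet A B T ∣ + ∣ A ∣ ≡ ∣ S ∩ T ∣ + ∣ B ∣
shift-shift A B S T A⊆S A⊆T S∩B=∅ T∩B=∅ =
  count-pointwise (shiftSet A B S ∩ shiftSet A B T) A (S ∩ T) B pointwise
  where
  pointwise : ∀ i → 𝟙 (lookup (shiftSet A B S ∩ shiftSet A B T) i) + 𝟙 (lookup A i)
                  ≡ 𝟙 (lookup (S ∩ T) i) + 𝟙 (lookup B i)
  pointwise i
    rewrite bit-∩ (shiftSet A B S) (shiftSet A B T) i | bit-∪ (S ─ A) B i | bit-∪ (T ─ A) B i
          | bit-─ S A i | bit-─ T A i | bit-∩ S T i
    = shift-shift-bit _ _ _ _ (⊆⇒bit≤ A⊆S i) (⊆⇒bit≤ A⊆T i)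
                              (disjoint⇒bit S∩B=∅ i) (disjoint⇒bit T∩B=∅ i)

compression-meet : ∀ {n} (C D S Y : Subset n) → C ⊆ S → C ⊆ Y → Disjoint S D →
  ∣ S ∩ shiftSet C D Y ∣ + ∣ C ∣ ≡ ∣ S ∩ Y ∣
compression-meet C D S Y C⊆S C⊆Y S∩D=∅ =
  count-pointwise₃ (S ∩ shiftSet C D Y) C (S ∩ Y) pointwise
  where
  pointwise : ∀ i → 𝟙 (lookup (S ∩ shiftSet C D Y) i) + 𝟙 (lookup C i) ≡ 𝟙 (lookup (S ∩ Y) i)
  pointwise i
    rewrite bit-∩ S (shiftSet C D Y) i | bit-∪ (Y ─ C) D i | bit-─ Y C i | bit-∩ S Y i
    = compression-meet-bit _ _ _ _ (⊆⇒bit≤ C⊆S i) (⊆⇒bit≤ C⊆Y i) (disjoint⇒bit S∩D=∅ i)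

∣─∣+∣∩∣ : ∀ {n} (X Y : Subset n) → ∣ X ─ Y ∣ + ∣ X ∩ Y ∣ ≡ ∣ X ∣
∣─∣+∣∩∣ X Y = count-pointwise₃ (X ─ Y) (X ∩ Y) X pointwise
  where
  pointwise : ∀ i → 𝟙 (lookup (X ─ Y) i) + 𝟙 (lookup (X ∩ Y) i) ≡ 𝟙 (lookup X i)
  pointwise i rewrite bit-─ X Y i | bit-∩ X Y i = split-bit _ _

∣p∣≡0⇒Empty : ∀ {n} {p : Subset n} → ∣ p ∣ ≡ 0 → Empty p
∣p∣≡0⇒Empty {p = p} ∣p∣≡0 (x , x∈p) = n≮0 (subst (∣ p - x ∣ <_) ∣p∣≡0 (x∈p⇒∣p-x∣<∣p∣ x∈p))

∣p∣≡suc⇒¬Empty : ∀ {n r} {p : Subset n} → ∣ p ∣ ≡ suc r → ¬ Empty p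
∣p∣≡suc⇒¬Empty {n} {p = p} ∣p∣≡suc p=∅ =
  0≢1+n (trans (sym (∣⊥∣≡0 n)) (trans (cong ∣_∣ (sym (Empty-unique {p = p} p=∅))) ∣p∣≡suc))

∣∩∣≡∣∣⇒⊆ : ∀ {n} (X Y : Subset n) → ∣ X ∩ Y ∣ ≡ ∣ X ∣ → X ⊆ Y
∣∩∣≡∣∣⇒⊆ X Y full {x} x∈X with x ∈? Y
... | yes x∈Y = x∈Y
... | no  x∉Y = ⊥-elim (∣p∣≡0⇒Empty ∣X─Y∣≡0 (x , x∈p∧x∉q⇒x∈p─q x∈X x∉Y))
  where
  ∣X─Y∣≡0 : ∣ X ─ Y ∣ ≡ 0
  ∣X─Y∣≡0 = +-cancelʳ-≡ ∣ X ∩ Y ∣ _ 0 (trans (∣─∣+∣∩∣ X Y) (sym full))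

Disjoint-⊆ : ∀ {n} {A B C D : Subset n} → C ⊆ A → D ⊆ B → Disjoint A B → Disjoint C D
Disjoint-⊆ {C = C} {D} C⊆A D⊆B A∩B=∅ (x , x∈C∩D) with x∈p∩q⁻ C D x∈C∩D
... | x∈C , x∈D = A∩B=∅ (x , x∈p∩q⁺ (C⊆A x∈C , D⊆B x∈D))

Disjoint-─ : ∀ {n} (X Y : Subset n) → Disjoint Y (X ─ Y)
Disjoint-─ X Y (x , x∈Y∩X─Y) with x∈p∩q⁻ Y (X ─ Y) x∈Y∩X─Y
... | x∈Y , x∈X─Y = contradiction (trans lookup≡true lookup≡false) λ ()
  where
  lookup≡true : true ≡ lookup (X ─ Y) x
  lookup≡true = sym ([]=⇒lookup x∈X─Y)
  lookup≡false : lookup (X ─ Y) x ≡ false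
  lookup≡false = trans (bit-─ X Y x)
    (trans (cong (λ y → lookup X x ∧ not y) ([]=⇒lookup x∈Y)) (Boolₚ.∧-zeroʳ _))

choose : ∀ {n} (X : Subset n) k → k ≤ ∣ X ∣ → Σ (Subset n) λ C → C ⊆ X × ∣ C ∣ ≡ k
choose []            zero    _           = [] , ⊆-refl , refl
choose (outside ∷ X) k       k≤∣X∣       with choose X k k≤∣X∣
... | C , C⊆X , ∣C∣≡k = outside ∷ C , out⊆ C⊆X , ∣C∣≡k
choose {suc n} (inside ∷ X) zero _ = ⊥ , ⊥⊆ , ∣⊥∣≡0 (suc n)
choose (inside ∷ X)  (suc k) (s≤s k≤∣X∣) with choose X k k≤∣X∣
... | C , C⊆X , ∣C∣≡k = inside ∷ C , in⊆in C⊆X , cong suc ∣C∣≡k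

excess-bound : ∀ {t r k m a b} → t + r ≤ k → m + a ≡ k + b → a ≤ r + b → t ≤ m
excess-bound {t} {r} {k} {m} {a} {b} t+r≤k m+a≡k+b a≤r+b = +-cancelʳ-≤ a t m (begin
  t + a        ≤⟨ +-monoʳ-≤ t a≤r+b ⟩
  t + (r + b)  ≡⟨ +-assoc t r b ⟨
  t + r + b    ≤⟨ +-monoˡ-≤ b t+r≤k ⟩
  k + b        ≡⟨ m+a≡k+b ⟨
  m + a        ∎)
  where open ≤-Reasoning

room-outside : ∀ {n s r} (A B Y : Subset n) → ∣ A ∣ ≡ s → ∣ B ∣ ≡ suc s →
  r + ∣ B ∩ Y ∣ ≡ ∣ A ∩ Y ∣ → suc r ≤ ∣ B ─ Y ∣
room-outside {s = s} {r} A B Y ∣A∣≡s ∣B∣≡1+s r+b≡a = +-cancelʳ-≤ ∣ B ∩ Y ∣ _ _ (begin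
  suc r + ∣ B ∩ Y ∣      ≡⟨ cong suc r+b≡a ⟩
  suc ∣ A ∩ Y ∣          ≤⟨ s≤s (subst (_ ≤_) ∣A∣≡s (∣p∩q∣≤∣p∣ A Y)) ⟩
  suc s                  ≡⟨ trans (∣─∣+∣∩∣ B Y) ∣B∣≡1+s ⟨
  ∣ B ─ Y ∣ + ∣ B ∩ Y ∣  ∎)
  where open ≤-Reasoning

-- If b < a ≤ s and s ≤ a ∸ b, then a = s and b = 0: an excess a - b that is
-- not below s forces A ⊆ Y and Y ∩ B = ∅.
saturated : ∀ {a b s} → b < a → a ≤ s → s ≤ a ∸ b → a ≡ s × b ≡ 0
saturated {a} {b} {s} b<a a≤s s≤a∸b = a≡s , b≡0
  where
  a≡s : a ≡ s
  a≡s = ≤-antisym a≤s (≤-trans s≤a∸b (m∸n≤m a b))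
  a∸b≡a : a ∸ b ≡ a
  a∸b≡a = ≤-antisym (m∸n≤m a b) (≤-trans a≤s s≤a∸b)
  b≡0 : b ≡ 0
  b≡0 = +-cancelˡ-≡ a b 0
          (trans (trans (cong (_+ b) (sym a∸b≡a)) (m∸n+n≡m (<⇒≤ b<a))) (sym (+-identityʳ a)))

shifted⇒⊇ : ∀ {n} {C D S X : Subset n} → X ≡ shiftSet C D S → D ⊆ X
shifted⇒⊇ {C = C} {D} {S} refl = q⊆p∪q (S ─ C) D

kept⇒compressed : ∀ {n} {F : Family n} {C D Y : Subset n} → F Y → C ⊆ Y → Disjoint Y D →
  ¬ (InFAB F C D Y × ¬ F (shiftSet C D Y)) → ¬ ¬ F (shiftSet C D Y)
kept⇒compressed FY C⊆Y Y∩D=∅ kept ¬FY' = kept ((FY , C⊆Y , Y∩D=∅) , ¬FY')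

-- If S_{C,D} fixes F and D ≠ ∅, every Y ∈ F_{C,D} compresses into F:
-- Y misses D, so it is no image of the shift and hence was kept.
stable⇒compressed : ∀ {n} {F : Family n} {C D Y : Subset n} → Shift C D F ≐ F → ¬ Empty D →
  F Y → C ⊆ Y → Disjoint Y D → ¬ ¬ F (shiftSet C D Y)
stable⇒compressed {F = F} {Y = Y} fixed D≠∅ FY C⊆Y Y∩D=∅ with proj₂ (fixed Y) FY
... | inj₂ (_ , kept) = kept⇒compressed {F = F} FY C⊆Y Y∩D=∅ kept
... | inj₁ (_ , _ , _ , Y≡Z') =
  λ _ → D≠∅ λ (x , x∈D) → Y∩D=∅ (x , x∈p∩q⁺ (shifted⇒⊇ Y≡Z' x∈D , x∈D))

module _ {n t} {F : Family n} (F-int : IsTIntersecting t F) where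

  compressed⇒meet : ∀ {C D S Y} → F S → C ⊆ S → C ⊆ Y → Disjoint S D →
    ¬ ¬ F (shiftSet C D Y) → t + ∣ C ∣ ≤ ∣ S ∩ Y ∣
  compressed⇒meet {C} {D} {S} {Y} FS C⊆S C⊆Y S∩D=∅ ¬¬FY' =
    decidable-stable (_ ≤? _) λ ¬bound → ¬¬FY' λ FY' →
      ¬bound (subst (t + ∣ C ∣ ≤_) (compression-meet C D S Y C⊆S C⊆Y S∩D=∅)
                    (+-monoˡ-≤ ∣ C ∣ (F-int S (shiftSet C D Y) FS FY')))

  -- Two shifted members: |S' ∩ T'| = |S ∩ T| + 1.
  shifted-meet-shifted : ∀ {s A B S T} → ∣ A ∣ ≡ s → ∣ B ∣ ≡ suc s →
    InFAB F A B S → InFAB F A B T → t ≤ ∣ shiftSet A B S ∩ shiftSet A B T ∣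
  shifted-meet-shifted {s} {A} {B} {S} {T} ∣A∣≡s ∣B∣≡1+s (FS , A⊆S , S∩B=∅) (FT , A⊆T , T∩B=∅) =
    ≤-trans (F-int S T FS FT) (+-cancelʳ-≤ s _ _ (begin
      ∣ S ∩ T ∣ + s                             ≤⟨ +-monoʳ-≤ ∣ S ∩ T ∣ (n≤1+n s) ⟩
      ∣ S ∩ T ∣ + suc s                         ≡⟨ cong (∣ S ∩ T ∣ +_) ∣B∣≡1+s ⟨
      ∣ S ∩ T ∣ + ∣ B ∣                         ≡⟨ shift-shift A B S T A⊆S A⊆T S∩B=∅ T∩B=∅ ⟨
      ∣ shiftSet A B S ∩ shiftSet A B T ∣ + ∣ A ∣ ≡⟨ cong (_ +_) ∣A∣≡s ⟩
      ∣ shiftSet A B S ∩ shiftSet A B T ∣ + s     ∎))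
    where open ≤-Reasoning

  meet-via-stability : ∀ {r s A B S Y} → Disjoint A B → ∣ A ∣ ≡ s → ∣ B ∣ ≡ suc s →
    IsStable r F → InFAB F A B S → F Y → r + ∣ B ∩ Y ∣ ≡ ∣ A ∩ Y ∣ → t + r ≤ ∣ S ∩ Y ∣
  meet-via-stability {r} {A = A} {B} {S} {Y} A∩B=∅ ∣A∣≡s ∣B∣≡1+s stable (FS , A⊆S , S∩B=∅) FY r+b≡a
    with choose (A ∩ Y) r (≤-trans (m≤m+n r _) (≤-reflexive r+b≡a))
       | choose (B ─ Y) (suc r) (room-outside A B Y ∣A∣≡s ∣B∣≡1+s r+b≡a)
  ... | C , C⊆A∩Y , ∣C∣≡r | D , D⊆B─Y , ∣D∣≡1+r =
    subst (λ c → t + c ≤ ∣ S ∩ Y ∣) ∣C∣≡r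
      (compressed⇒meet FS (A⊆S ∘ C⊆A) C⊆Y (Disjoint-⊆ ⊆-refl D⊆B S∩B=∅)
        (stable⇒compressed {F = F} (stable C D (Disjoint-⊆ C⊆A D⊆B A∩B=∅) ∣C∣≡r ∣D∣≡1+r)
          (∣p∣≡suc⇒¬Empty ∣D∣≡1+r) FY C⊆Y (Disjoint-⊆ ⊆-refl D⊆B─Y (Disjoint-─ B Y))))
    where
    C⊆A : C ⊆ A
    C⊆A = p∩q⊆p A Y ∘ C⊆A∩Y
    C⊆Y : C ⊆ Y
    C⊆Y = p∩q⊆q A Y ∘ C⊆A∩Y
    D⊆B : D ⊆ B
    D⊆B = p─q⊆p B Y ∘ D⊆B─Y

  -- When A ⊆ Y and Y ∩ B = ∅, Y ∈ F_{A,B}; being kept, it compresses along (A, B).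
  meet-via-kept : ∀ {A B S Y} → InFAB F A B S → F Y → ∣ A ∩ Y ∣ ≡ ∣ A ∣ → ∣ B ∩ Y ∣ ≡ 0 →
    ¬ (InFAB F A B Y × ¬ F (shiftSet A B Y)) → t + ∣ A ∣ ≤ ∣ S ∩ Y ∣
  meet-via-kept {A} {B} {Y = Y} (FS , A⊆S , S∩B=∅) FY a≡∣A∣ b≡0 kept =
    compressed⇒meet FS A⊆S A⊆Y S∩B=∅ (kept⇒compressed {F = F} FY A⊆Y Y∩B=∅ kept)
    where
    A⊆Y : A ⊆ Y
    A⊆Y = ∣∩∣≡∣∣⇒⊆ A Y a≡∣A∣
    Y∩B=∅ : Disjoint Y B
    Y∩B=∅ = subst Empty (∩-comm B Y) (∣p∣≡0⇒Empty b≡0)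

  -- Take r = 0 if |A ∩ Y| ≤ |B ∩ Y|,
  -- else r = |A ∩ Y| - |B ∩ Y|, using stability if r < s and the kept Y if r = s.
  excess-witness : ∀ {s A B S Y} → Disjoint A B → ∣ A ∣ ≡ s → ∣ B ∣ ≡ suc s →
    (∀ r → r < s → IsStable r F) → InFAB F A B S → F Y →
    ¬ (InFAB F A B Y × ¬ F (shiftSet A B Y)) →
    Σ ℕ λ r → t + r ≤ ∣ S ∩ Y ∣ × ∣ A ∩ Y ∣ ≤ r + ∣ B ∩ Y ∣
  excess-witness {s} {A} {B} {S} {Y} A∩B=∅ ∣A∣≡s ∣B∣≡1+s stable S∈F_AB@(FS , _ , _) FY kept
    with ∣ A ∩ Y ∣ ≤? ∣ B ∩ Y ∣ | ∣ A ∩ Y ∣ ∸ ∣ B ∩ Y ∣ <? s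
  ... | yes a≤b | _ = 0 , subst (_≤ ∣ S ∩ Y ∣) (sym (+-identityʳ t)) (F-int S Y FS FY) , a≤b
  ... | no a≰b | yes r<s =
    _ , meet-via-stability A∩B=∅ ∣A∣≡s ∣B∣≡1+s (stable _ r<s) S∈F_AB FY r+b≡a , ≤-reflexive (sym r+b≡a)
    where
    r+b≡a : ∣ A ∩ Y ∣ ∸ ∣ B ∩ Y ∣ + ∣ B ∩ Y ∣ ≡ ∣ A ∩ Y ∣
    r+b≡a = m∸n+n≡m (<⇒≤ (≰⇒> a≰b))
  ... | no a≰b | no r≮s with saturated (≰⇒> a≰b) (subst (_ ≤_) ∣A∣≡s (∣p∩q∣≤∣p∣ A Y)) (≮⇒≥ r≮s)
  ...   | a≡s , b≡0 =
    s , subst (λ c → t + c ≤ ∣ S ∩ Y ∣) ∣A∣≡s (meet-via-kept S∈F_AB FY (trans a≡s (sym ∣A∣≡s)) b≡0 kept)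
      , ≤-trans (≤-reflexive a≡s) (m≤m+n s _)

  -- A shifted member S' against a kept member Y, via |S' ∩ Y| + |A ∩ Y| = |S ∩ Y| + |B ∩ Y|.
  shifted-meet-kept : ∀ {s A B S Y} → Disjoint A B → ∣ A ∣ ≡ s → ∣ B ∣ ≡ suc s →
    (∀ r → r < s → IsStable r F) → InFAB F A B S → F Y →
    ¬ (InFAB F A B Y × ¬ F (shiftSet A B Y)) → t ≤ ∣ shiftSet A B S ∩ Y ∣
  shifted-meet-kept {A = A} {B} {S} {Y} A∩B=∅ ∣A∣≡s ∣B∣≡1+s stable S∈F_AB@(_ , A⊆S , S∩B=∅) FY kept =
    let r , bound , cover = excess-witness A∩B=∅ ∣A∣≡s ∣B∣≡1+s stable S∈F_AB FY kept
    in excess-bound bound (shift-meet A B S Y A⊆S S∩B=∅) cover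

lemma2p38 : (n t s : ℕ) (F : Family n) (A B : Subset n) →
    IsTIntersecting t F → Disjoint A B → ∣ A ∣ ≡ s → ∣ B ∣ ≡ suc s →
    (∀ r → r < s → IsStable r F) →
    IsTIntersecting t (Shift A B F)
lemma2p38 _ t _ F A B F-int A∩B=∅ ∣A∣≡s ∣B∣≡1+s stable = meets
  where
  meets : IsTIntersecting t (Shift A B F)
  meets _ _ (inj₁ (S , S∈F_AB , _ , refl)) (inj₁ (T , T∈F_AB , _ , refl)) =
    shifted-meet-shifted F-int ∣A∣≡s ∣B∣≡1+s S∈F_AB T∈F_AB
  meets _ _ (inj₁ (S , S∈F_AB , _ , refl)) (inj₂ (FY , kept)) =
    shifted-meet-kept F-int A∩B=∅ ∣A∣≡s ∣B∣≡1+s stable S∈F_AB FY kept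
  meets X _ (inj₂ (FX , kept)) (inj₁ (S , S∈F_AB , _ , refl)) =
    subst (t ≤_) (cong ∣_∣ (∩-comm (shiftSet A B S) X))
      (shifted-meet-kept F-int A∩B=∅ ∣A∣≡s ∣B∣≡1+s stable S∈F_AB FX kept)
  meets X Y (inj₂ (FX , _)) (inj₂ (FY , _)) = F-int X Y FX FY
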